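{- Let $x$ be an infinite word over the alphabet $\{0,1\}$. If $x$ avoids $3$-anti-powers, then $x$ has no factor of the form $10^n1$ or $01^n0$ with $n>1$.
   Context: A $3$-anti-power is a word $u_1u_2u_3$ with $u_1,u_2,u_3$ non-empty words of the same length that are pairwise distinct. An infinite word avoids $3$-anti-powers if none of its factors (blocks of consecutive letters) is a $3$-anti-power. $0^n$ denotes $n$ consecutive $0$'s. -}

module Defs where

open import Data.Nat using (ℕ; zero; suc; _+_; _*_; _<_; _>_)
open import Data.Bool using (Bool; true; false)
open import Data.Vec using (Vec; tabulate; _∷_; [])
open import Data.Vec.Properties using ()
open import Data.Fin using (Fin; toℕ)
open import Data.Product using (Σ; _×_; ∃-syntax)
open import Relation.Binary.PropositionalEquality using (_≡_; _≢_)
open import Relation.Nullary using (¬_)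

-- Binary alphabet {0,1}: false = 0, true = 1.
-- An infinite word over {0,1} is a map ℕ → Bool (letter at position i).
InfWord : Set
InfWord = ℕ → Bool

factor : InfWord → (i L : ℕ) → Vec Bool L
factor x i L = tabulate (λ (k : Fin L) → x (i + toℕ k))

IsFactor : ∀ {L} → Vec Bool L → InfWord → Set
IsFactor {L} w x = ∃[ i ] factor x i L ≡ w

Is3AntiPower : ∀ {m} → Vec Bool m → Vec Bool m → Vec Bool m → Set
Is3AntiPower {m} u₁ u₂ u₃ = (m > 0) × (u₁ ≢ u₂) × (u₁ ≢ u₃) × (u₂ ≢ u₃)

Avoids3AntiPowers : InfWord → Set
Avoids3AntiPowers x =
  ∀ (i m : ℕ) → ¬ Is3AntiPower (factor x i m) (factor x (i + m) m) (factor x (i + m + m) m)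

rep : (n : ℕ) → Bool → Vec Bool n
rep zero    a = []
rep (suc n) a = a ∷ rep n a

abna : Bool → Bool → (n : ℕ) → Vec Bool (suc (n + 1))
abna a b n = a ∷ (rep n b Data.Vec.++ (a ∷ []))

-- Suppose a bⁿ a (a ≠ b) starts at position 0. If n = 2m + r with r + 1 < m,
-- the three blocks of length m starting there are pairwise distinct: only the
-- first begins with a, and the third reaches the closing a at offset r + 1,
-- where the second still reads b. Such m exists for every n ≥ 6. For
-- 2 ≤ n ≤ 5 no extension of a bⁿ a by eight letters avoids 3-anti-powers,
-- which is decided by exhaustive search.
module Submission where

open import Defs
open import Data.Nat using (ℕ; _>_)
open import Data.Bool using (true; false)
open import Relation.Nullary using (¬_)
open import Data.Product using (_×_)

open import Function using (_∘_)
open import Data.Bool using (Bool; not)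
open import Data.Bool.Properties using (not-¬) renaming (_≟_ to _≟ᵇ_)
open import Data.Nat using (zero; suc; _+_; _≤_; _<_; z≤n; s≤s; z<s; _≤?_; _<?_)
open import Data.Nat.Properties
  using (anyUpTo?; +-assoc; +-suc; +-identityʳ; m≤m+n; m<m+n; m≤n⇒m≤n+o; +-monoʳ-≤; +-monoʳ-<;
         ≤-refl; ≤-trans; <-trans; <-≤-trans; <⇒≤)
open import Data.Vec using (Vec; []; _∷_; _++_; tabulate; lookup)
open import Data.Vec.Properties using (≡-dec; tabulate-cong; lookup∘tabulate)
open import Data.Fin using (toℕ; fromℕ<)
open import Data.Fin.Properties using (toℕ<n; toℕ-fromℕ<)
open import Data.Fin.Subset.Properties using (anySubset?)
open import Data.Product using (∃; ∃₂; _,_)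
open import Relation.Nullary using (Dec; ¬?; _×-dec_)
open import Relation.Nullary.Decidable using (False; toWitnessFalse)
open import Relation.Binary.PropositionalEquality

Is3AntiPowerAt : InfWord → ℕ → ℕ → Set
Is3AntiPowerAt y i m = Is3AntiPower (factor y i m) (factor y (i + m) m) (factor y (i + m + m) m)

is3AntiPowerAt? : ∀ y i m → Dec (Is3AntiPowerAt y i m)
is3AntiPowerAt? y i m =
  0 <? m ×-dec ¬? (u₁ ≟ u₂) ×-dec ¬? (u₁ ≟ u₃) ×-dec ¬? (u₂ ≟ u₃)
  where
  _≟_ = ≡-dec _≟ᵇ_
  u₁ = factor y i m
  u₂ = factor y (i + m) m
  u₃ = factor y (i + m + m) m

antiPower-resp : ∀ {m} {u₁ u₂ u₃ v₁ v₂ v₃ : Vec Bool m} →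
  u₁ ≡ v₁ → u₂ ≡ v₂ → u₃ ≡ v₃ → Is3AntiPower u₁ u₂ u₃ → Is3AntiPower v₁ v₂ v₃
antiPower-resp refl refl refl p = p

factor-cong : ∀ {y z : InfWord} i m → (∀ {k} → k < m → y (i + k) ≡ z (i + k)) →
  factor y i m ≡ factor z i m
factor-cong i m agree = tabulate-cong (λ k → agree (toℕ<n k))

lookup-factor : ∀ y i {m k} (k<m : k < m) → lookup (factor y i m) (fromℕ< k<m) ≡ y (i + k)
lookup-factor y i k<m =
  trans (lookup∘tabulate _ (fromℕ< k<m)) (cong (λ t → y (i + t)) (toℕ-fromℕ< k<m))

factor-≢ : ∀ y i j {m k} → k < m → y (i + k) ≢ y (j + k) → factor y i m ≢ factor y j m
factor-≢ y i j k<m differ eq = differ (begin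
  y (i + _)                                ≡⟨ lookup-factor y i k<m ⟨
  lookup (factor y i _) (fromℕ< k<m)       ≡⟨ cong (λ v → lookup v (fromℕ< k<m)) eq ⟩
  lookup (factor y j _) (fromℕ< k<m)       ≡⟨ lookup-factor y j k<m ⟩
  y (j + _)                                ∎)
  where open ≡-Reasoning

tabulate-+ : ∀ m {n} (g : InfWord) →
  tabulate {n = m + n} (g ∘ toℕ) ≡ tabulate {n = m} (g ∘ toℕ) ++ tabulate (λ k → g (m + toℕ k))
tabulate-+ zero    g = refl
tabulate-+ (suc m) g = cong (g 0 ∷_) (tabulate-+ m (g ∘ suc))

shift : ℕ → InfWord → InfWord
shift i x k = x (i + k)

factor-shift : ∀ x i j m {p} → i + j ≡ p → factor (shift i x) j m ≡ factor x p m
factor-shift x i j m refl = tabulate-cong (λ k → cong x (sym (+-assoc i j (toℕ k))))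

avoids-shift : ∀ x i → Avoids3AntiPowers x → Avoids3AntiPowers (shift i x)
avoids-shift x i avoids j m anti = avoids (i + j) m (antiPower-resp
  (factor-shift x i j m refl)
  (factor-shift x i (j + m) m (sym (+-assoc i j m)))
  (factor-shift x i (j + m + m) m
    (trans (sym (+-assoc i (j + m) m)) (cong (_+ m) (sym (+-assoc i j m)))))
  anti)

-- The finite word w read as an infinite word; letters past its end are false.
pad : ∀ {L} → Vec Bool L → InfWord
pad []      _       = false
pad (b ∷ w) zero    = b
pad (b ∷ w) (suc k) = pad w k

pad-tabulate : ∀ L (g : InfWord) {k} → k < L → pad (tabulate {n = L} (g ∘ toℕ)) k ≡ g k
pad-tabulate (suc L) g {zero}  _         = refl
pad-tabulate (suc L) g {suc k} (s≤s k<L) = pad-tabulate L (g ∘ suc) k<L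

prefix-pad : ∀ y {L k} {w : Vec Bool L} → factor y 0 L ≡ w → k < L → y k ≡ pad w k
prefix-pad y {L} {k} refl k<L = sym (pad-tabulate L y k<L)

pad-++ˡ : ∀ {n L k} (u : Vec Bool n) (w : Vec Bool L) → k < n → pad (u ++ w) k ≡ pad u k
pad-++ˡ {k = zero}  (b ∷ u) w _         = refl
pad-++ˡ {k = suc k} (b ∷ u) w (s≤s k<n) = pad-++ˡ u w k<n

pad-++ʳ : ∀ {n L} (u : Vec Bool n) (w : Vec Bool L) k → pad (u ++ w) (n + k) ≡ pad w k
pad-++ʳ []      w k = refl
pad-++ʳ (b ∷ u) w k = pad-++ʳ u w k

pad-rep : ∀ {n k} b → k < n → pad (rep n b) k ≡ b
pad-rep {k = zero}  b (s≤s _)   = refl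
pad-rep {k = suc k} b (s≤s k<n) = pad-rep b k<n

-- The bounds i < L and m < L follow from the third conjunct; they only make
-- the search finite.
AntiPowerWithin : ℕ → InfWord → Set
AntiPowerWithin L y = ∃ λ i → i < L × ∃ λ m → m < L × i + m + m + m ≤ L × Is3AntiPowerAt y i m

antiPowerWithin? : ∀ L y → Dec (AntiPowerWithin L y)
antiPowerWithin? L y =
  anyUpTo? (λ i → anyUpTo? (λ m → i + m + m + m ≤? L ×-dec is3AntiPowerAt? y i m) L) L

avoids⇒¬antiPowerWithin : ∀ {y z L} → Avoids3AntiPowers y → (∀ {k} → k < L → z k ≡ y k) →
  ¬ AntiPowerWithin L z
avoids⇒¬antiPowerWithin {y} {z} {L} avoids agree (i , _ , m , _ , fits , anti) =
  avoids i m (antiPower-resp (same i fits₁) (same (i + m) fits₂) (same (i + m + m) fits) anti)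
  where
  fits₂ : i + m + m ≤ L
  fits₂ = ≤-trans (m≤m+n (i + m + m) m) fits
  fits₁ : i + m ≤ L
  fits₁ = ≤-trans (m≤m+n (i + m) m) fits₂
  same : ∀ p → p + m ≤ L → factor z p m ≡ factor y p m
  same p p+m≤L = factor-cong {z} {y} p m (λ k<m → agree (<-≤-trans (+-monoʳ-< p k<m) p+m≤L))

AntiPowerFreeExtension : ∀ {L} → Vec Bool L → ℕ → Set
AntiPowerFreeExtension {L} w D = ∃ λ (v : Vec Bool D) → ¬ AntiPowerWithin (L + D) (pad (w ++ v))

antiPowerFreeExtension? : ∀ {L} (w : Vec Bool L) D → Dec (AntiPowerFreeExtension w D)
antiPowerFreeExtension? {L} w D = anySubset? (λ v → ¬? (antiPowerWithin? (L + D) (pad (w ++ v))))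

avoids⇒prefix-extends : ∀ y {L} (w : Vec Bool L) D → Avoids3AntiPowers y → factor y 0 L ≡ w →
  AntiPowerFreeExtension w D
avoids⇒prefix-extends y {L} w D avoids prefix =
  factor y L D , avoids⇒¬antiPowerWithin {y} avoids agree
  where
  open ≡-Reasoning
  agree : ∀ {k} → k < L + D → pad (w ++ factor y L D) k ≡ y k
  agree {k} k<L+D = begin
    pad (w ++ factor y L D) k              ≡⟨ cong (λ u → pad (u ++ factor y L D) k) prefix ⟨
    pad (factor y 0 L ++ factor y L D) k   ≡⟨ cong (λ v → pad v k) (tabulate-+ L y) ⟨
    pad (factor y 0 (L + D)) k             ≡⟨ pad-tabulate (L + D) y k<L+D ⟩
    y k                                    ∎

avoids⇒prefix≢ : ∀ y {L} {w : Vec Bool L} D {_ : False (antiPowerFreeExtension? w D)} →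
  Avoids3AntiPowers y → factor y 0 L ≢ w
avoids⇒prefix≢ y {w = w} D {none} avoids prefix =
  toWitnessFalse none (avoids⇒prefix-extends y w D avoids prefix)

record Framed (a b : Bool) (n : ℕ) (y : InfWord) : Set where
  field
    first : y 0 ≡ a
    inner : ∀ {k} → 0 < k → k ≤ n → y k ≡ b
    last  : y (suc n) ≡ a

prefix⇒framed : ∀ {a b n} y → factor y 0 (suc (n + 1)) ≡ abna a b n → Framed a b n y
prefix⇒framed {a} {b} {n} y prefix = record
  { first = prefix-pad y prefix z<s
  ; inner = inner
  ; last  = trans (prefix-pad y prefix (s≤s (m<m+n n z<s)))
                  (subst (λ p → pad (rep n b ++ a ∷ []) p ≡ a) (+-identityʳ n)
                         (pad-++ʳ (rep n b) (a ∷ []) 0))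
  }
  where
  inner : ∀ {k} → 0 < k → k ≤ n → y k ≡ b
  inner {suc k} _ k<n = trans (prefix-pad y prefix (s≤s (m≤n⇒m≤n+o 1 k<n)))
                              (trans (pad-++ˡ (rep n b) (a ∷ []) k<n) (pad-rep b k<n))

framed-antiPower : ∀ {a b y} m r → a ≢ b → suc r < m → Framed a b (m + m + r) y →
  Is3AntiPowerAt y 0 m
framed-antiPower {a} {b} {y} m r a≢b r<m framing =
  0<m , factor-≢ y 0 m       0<m (differ first b-at-m)
      , factor-≢ y 0 (m + m) 0<m (differ first b-at-2m)
      , factor-≢ y m (m + m) r<m (≢-sym (differ a-at-2m+r+1 b-at-m+r+1))
  where
  open Framed framing
  0<m : 0 < m
  0<m = <-trans z<s r<m
  differ : ∀ {i j} → y i ≡ a → y j ≡ b → y i ≢ y j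
  differ yi≡a yj≡b yi≡yj = a≢b (trans (sym yi≡a) (trans yi≡yj yj≡b))
  b-at-m : y (m + 0) ≡ b
  b-at-m = inner (m≤n⇒m≤n+o 0 0<m) (m≤n⇒m≤n+o r (+-monoʳ-≤ m z≤n))
  b-at-2m : y (m + m + 0) ≡ b
  b-at-2m = inner (m≤n⇒m≤n+o 0 (m≤n⇒m≤n+o m 0<m)) (+-monoʳ-≤ (m + m) z≤n)
  b-at-m+r+1 : y (m + suc r) ≡ b
  b-at-m+r+1 = inner (m≤n⇒m≤n+o (suc r) 0<m) (m≤n⇒m≤n+o r (+-monoʳ-≤ m (<⇒≤ r<m)))
  a-at-2m+r+1 : y (m + m + suc r) ≡ a
  a-at-2m+r+1 = trans (cong y (+-suc (m + m) r)) last

block-split : ∀ k → ∃₂ λ m r → 6 + k ≡ m + m + r × suc r < m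
block-split 0 = 3 , 0 , refl , s≤s (s≤s z≤n)
block-split 1 = 3 , 1 , refl , ≤-refl
block-split 2 = 4 , 0 , refl , s≤s (s≤s z≤n)
block-split (suc (suc (suc k))) with block-split k
... | m , r , eq , r<m =
  suc m , suc r , trans (cong (suc ∘ suc ∘ suc) eq) (cong suc (sym regroup)) , s≤s r<m
  where
  regroup : m + suc m + suc r ≡ suc (suc (m + m + r))
  regroup = trans (+-suc (m + suc m) r) (cong (λ p → suc (p + r)) (+-suc m m))

avoids⇒abⁿa≢prefix : ∀ y a n → 1 < n → Avoids3AntiPowers y →
  factor y 0 (suc (n + 1)) ≢ abna a (not a) n
avoids⇒abⁿa≢prefix _ _ 0 ()
avoids⇒abⁿa≢prefix _ _ 1 (s≤s ())
avoids⇒abⁿa≢prefix y true  2 _ = avoids⇒prefix≢ y 8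
avoids⇒abⁿa≢prefix y false 2 _ = avoids⇒prefix≢ y 8
avoids⇒abⁿa≢prefix y true  3 _ = avoids⇒prefix≢ y 8
avoids⇒abⁿa≢prefix y false 3 _ = avoids⇒prefix≢ y 8
avoids⇒abⁿa≢prefix y true  4 _ = avoids⇒prefix≢ y 8
avoids⇒abⁿa≢prefix y false 4 _ = avoids⇒prefix≢ y 8
avoids⇒abⁿa≢prefix y true  5 _ = avoids⇒prefix≢ y 8
avoids⇒abⁿa≢prefix y false 5 _ = avoids⇒prefix≢ y 8
avoids⇒abⁿa≢prefix y a (suc (suc (suc (suc (suc (suc k)))))) _ avoids prefix
  with block-split k
... | m , r , n≡ , r<m = avoids 0 m (framed-antiPower m r (not-¬ refl) r<m framing)
  where
  framing : Framed a (not a) (m + m + r) y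
  framing = subst (λ n → Framed a (not a) n y) n≡ (prefix⇒framed y prefix)

proposition10 : (x : InfWord) → Avoids3AntiPowers x →
    (n : ℕ) → n > 1 →
      ¬ IsFactor (abna true false n) x × ¬ IsFactor (abna false true n) x
proposition10 x avoids n 1<n = absent true , absent false
  where
  absent : ∀ a → ¬ IsFactor (abna a (not a) n) x
  absent a (i , occurs) = avoids⇒abⁿa≢prefix (shift i x) a n 1<n (avoids-shift x i avoids) occurs
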